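{- Let $I=\{0,\dots,n\}$, $n\in\mathbb{N}$, let $(G,(K_{\{i\}})_{i\in I})$ be a subgroup geometry system and let $\Gamma\le\operatorname{Aut}(G)$ preserve the subgroup geometry system. For $\gamma\in\Gamma$ define $\psi_\gamma\in\operatorname{Sym}(\{0,\dots,n\})$ by $\gamma(K_{\{i\}})=K_{\{\psi_\gamma(i)\}}$ for $0\le i\le n$. Then: (1) $\psi_\gamma$ is well defined (a permutation); (2) $\Psi:\Gamma\to\operatorname{Sym}(\{0,\dots,n\})$, $\Psi(\gamma)=\psi_\gamma$, is a group homomorphism; (3) for every $\tau\subseteq I$, $\gamma(K_\tau)=K_{\psi_\gamma(\tau)}$.
   Context: $K_\tau=\bigcap_{i\in\tau}K_{\{i\}}$ for $\emptyset\ne\tau\subseteq I$, $K_\emptyset=G$. $(G,(K_{\{i\}})_{i\in I})$ is a subgroup geometry system if (A1) $K_{\tau\cap\tau'}=\langle K_\tau,K_{\tau'}\rangle$ for all $\tau,\tau'\subseteq I$; (A2) $K_\tau K_{\{i\}}=\bigcap_{j\in\tau}K_{\{j\}}K_{\{i\}}$ for every $\tau\subsetneq I$, $i\in I\setminus\tau$; (A3) $K_I\ne K_{I\setminus\{i\}}$ for every $i$. An automorphism $\gamma$ of $G$ preserves the subgroup geometry system if $\{\gamma(K_{\{i\}}): i\in I\}=\{K_{\{i\}}: i\in I\}$; $\Gamma$ preserves it if every element does. -}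

module Defs where

open import Level using (Level; _⊔_)
open import Data.Nat using (ℕ; suc)
open import Data.Fin using (Fin)
open import Data.Fin.Subset using (Subset; _∈_; _∉_; _∩_; ⊤) renaming (_-_ to _∖_)
open import Data.Fin.Permutation using (Permutation′; _⟨$⟩ˡ_)
open import Data.Vec using (tabulate; lookup)
open import Data.Product using (Σ; ∃; _×_)
open import Relation.Unary using (Pred; _≐_; _∪_)
open import Relation.Nullary using (¬_)
open import Algebra.Bundles using (Group)
open import Algebra.Morphism.Structures using (IsGroupHomomorphism)
open import Function.Definitions using (Bijective)

module _ {c ℓ : Level} (G : Group c ℓ) where
  open Group G hiding (_-_)

  record IsSubgroup {ℓ'} (H : Pred Carrier ℓ') : Set (c ⊔ ℓ ⊔ ℓ') where
    field
      resp  : ∀ {x y} → x ≈ y → H x → H y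
      ε∈    : H ε
      ∙∈    : ∀ {x y} → H x → H y → H (x ∙ y)
      ⁻¹∈   : ∀ {x} → H x → H (x ⁻¹)

  data ⟨_⟩ {ℓ'} (S : Pred Carrier ℓ') : Pred Carrier (c ⊔ ℓ ⊔ ℓ') where
    gen  : ∀ {x} → S x → ⟨ S ⟩ x
    unit : ⟨ S ⟩ ε
    mul  : ∀ {x y} → ⟨ S ⟩ x → ⟨ S ⟩ y → ⟨ S ⟩ (x ∙ y)
    inv  : ∀ {x} → ⟨ S ⟩ x → ⟨ S ⟩ (x ⁻¹)
    gresp : ∀ {x y} → x ≈ y → ⟨ S ⟩ x → ⟨ S ⟩ y

  _·_ : ∀ {ℓ₁ ℓ₂} → Pred Carrier ℓ₁ → Pred Carrier ℓ₂ → Pred Carrier (c ⊔ ℓ ⊔ ℓ₁ ⊔ ℓ₂)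
  (A · B) x = Σ Carrier λ a → Σ Carrier λ b → A a × B b × (x ≈ a ∙ b)

  img : ∀ {ℓ'} → (Carrier → Carrier) → Pred Carrier ℓ' → Pred Carrier (c ⊔ ℓ ⊔ ℓ')
  img f A x = Σ Carrier λ a → A a × (x ≈ f a)

  module _ {n : ℕ} {ℓ' : Level} (K : Fin (suc n) → Pred Carrier ℓ') where

    -- K_τ = ⋂_{i ∈ τ} K_{i}   (so K_∅ = G)
    Kτ : Subset (suc n) → Pred Carrier ℓ'
    Kτ τ x = ∀ i → i ∈ τ → K i x

    ⋂KK : Subset (suc n) → Fin (suc n) → Pred Carrier (c ⊔ ℓ ⊔ ℓ')
    ⋂KK τ i x = ∀ j → j ∈ τ → (K j · K i) x

    record IsSubgroupGeometrySystem : Set (c ⊔ ℓ ⊔ ℓ') where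
      field
        subgroups : ∀ i → IsSubgroup (K i)
        A1 : ∀ τ τ′ → Kτ (τ ∩ τ′) ≐ ⟨ Kτ τ ∪ Kτ τ′ ⟩
        A2 : ∀ τ i → i ∉ τ → (Kτ τ · K i) ≐ ⋂KK τ i
        A3 : ∀ i → ¬ (Kτ ⊤ ≐ Kτ (⊤ ∖ i))

  record Aut : Set (c ⊔ ℓ) where
    field
      fun     : Carrier → Carrier
      isHom   : IsGroupHomomorphism rawGroup rawGroup fun
      bij     : Bijective _≈_ _≈_ fun

  open Aut public

  record IsAutSubgroup {ℓ''} (Γ : Pred Aut ℓ'') : Set (c ⊔ ℓ ⊔ ℓ'') where
    field
      Γresp : ∀ {γ δ} → (∀ x → fun γ x ≈ fun δ x) → Γ γ → Γ δ
      id∈  : Σ Aut λ η → Γ η × (∀ x → fun η x ≈ x)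
      ∘∈   : ∀ {γ δ} → Γ γ → Γ δ → Σ Aut λ η → Γ η × (∀ x → fun η x ≈ fun γ (fun δ x))
      ⁻¹∈  : ∀ {γ} → Γ γ → Σ Aut λ δ → Γ δ × (∀ x → fun δ (fun γ x) ≈ x)

  -- Γ preserves the system: {γ(K_i)} = {K_i} as sets of subgroups, for each γ ∈ Γ
  Preserves : ∀ {n ℓ' ℓ''} → (Fin (suc n) → Pred Carrier ℓ') → Pred Aut ℓ'' → Set _
  Preserves K Γ = ∀ γ → Γ γ →
      (∀ i → ∃ λ j → img (fun γ) (K i) ≐ K j)
    × (∀ j → ∃ λ i → img (fun γ) (K i) ≐ K j)

-- image ψ(τ) of a subset τ under a permutation ψ : j ∈ ψ(τ) iff ψ⁻¹(j) ∈ τ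
permImage : ∀ {m} → Permutation′ m → Subset m → Subset m
permImage ψ τ = tabulate λ j → lookup τ (ψ ⟨$⟩ˡ j)

-- By A3 the subgroups K_i are pairwise distinct: if K_i = K_j with i ≠ j, then
-- removing j from I does not change K_I. Hence the index of γ(K_i) is uniquely
-- determined, and since γ is injective on subsets, γ⁻¹ induces the inverse map,
-- so ψ_γ is a permutation. Uniqueness of indices gives ψ_{γδ} = ψ_γ ψ_δ, and a
-- bijection maps an intersection to the intersection of the images, so
-- γ(K_τ) = ⋂_{i ∈ τ} K_{ψ_γ(i)} = K_{ψ_γ(τ)}.
module Submission where

open import Defs
open import Level using (Level)
open import Data.Nat using (ℕ; suc)
open import Data.Fin using (Fin; _≟_)
open import Data.Fin.Subset using (Subset; _∈_; _-_; ⊤)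
open import Data.Fin.Subset.Properties using (∈⊤; x∈p∧x≢y⇒x∈p-y)
open import Data.Fin.Permutation
  using (Permutation′; _⟨$⟩ʳ_; _⟨$⟩ˡ_; permutation; inverseˡ; inverseʳ)
open import Data.Product using (Σ; ∃; _×_; _,_; proj₁; proj₂)
open import Data.Vec using (lookup; tabulate)
open import Data.Vec.Properties using (lookup∘tabulate; []=⇒lookup; lookup⇒[]=)
open import Relation.Unary using (Pred; _≐_; _⊆_)
open import Relation.Unary.Properties using (≐-sym; ≐-trans)
open import Relation.Binary.Definitions using (_Respects_)
open import Relation.Binary.PropositionalEquality
  using (_≡_; refl; sym; trans; subst)
open import Relation.Nullary using (¬_; yes; no)
open import Data.Empty using (⊥-elim)
open import Algebra.Bundles using (Group)
open import Algebra.Morphism.Structures using (module IsGroupHomomorphism)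

module _ {m : ℕ} (ψ : Permutation′ m) {τ : Subset m} where

  lookup-permImage : ∀ j → lookup (permImage ψ τ) j ≡ lookup τ (ψ ⟨$⟩ˡ j)
  lookup-permImage = lookup∘tabulate (λ j → lookup τ (ψ ⟨$⟩ˡ j))

  ∈-permImage⁻ : ∀ {j} → j ∈ permImage ψ τ → ψ ⟨$⟩ˡ j ∈ τ
  ∈-permImage⁻ {j} j∈ψτ =
    lookup⇒[]= _ τ (trans (sym (lookup-permImage j)) ([]=⇒lookup j∈ψτ))

  ∈-permImage⁺ : ∀ {i} → i ∈ τ → ψ ⟨$⟩ʳ i ∈ permImage ψ τ
  ∈-permImage⁺ {i} i∈τ = lookup⇒[]= _ (permImage ψ τ)
    (trans (lookup-permImage (ψ ⟨$⟩ʳ i))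
           (subst (λ k → lookup τ k ≡ _) (sym (inverseˡ ψ)) ([]=⇒lookup i∈τ)))

module _ {c ℓ : Level} (G : Group c ℓ) where
  open Group G using (Carrier; _≈_) renaming (refl to ≈-refl; sym to ≈-sym; trans to ≈-trans)

  img-cong : ∀ {a b} (f : Carrier → Carrier) {A : Pred Carrier a} {B : Pred Carrier b}
           → A ≐ B → img G f A ≐ img G f B
  img-cong f (A⊆B , B⊆A) = (λ (a , a∈A , x≈fa) → a , A⊆B a∈A , x≈fa)
                         , (λ (a , a∈B , x≈fa) → a , B⊆A a∈B , x≈fa)

  module _ (γ : Aut G) where

    fun-cong : ∀ {x y} → x ≈ y → fun γ x ≈ fun γ y
    fun-cong = IsGroupHomomorphism.⟦⟧-cong (isHom γ)

    fun-injective : ∀ {x y} → fun γ x ≈ fun γ y → x ≈ y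
    fun-injective = proj₁ (bij γ)

    preimage : Carrier → Carrier
    preimage x = proj₁ (proj₂ (bij γ) x)

    fun∘preimage : ∀ x → fun γ (preimage x) ≈ x
    fun∘preimage x = proj₂ (proj₂ (bij γ) x) ≈-refl

    img⇒preimage : ∀ {a} {A : Pred Carrier a} → A Respects _≈_
                 → ∀ {x} → img G (fun γ) A x → A (preimage x)
    img⇒preimage resp {x} (a , a∈A , x≈γa) =
      resp (fun-injective (≈-trans (≈-sym x≈γa) (≈-sym (fun∘preimage x)))) a∈A

    preimage⇒img : ∀ {a} {A : Pred Carrier a} {x} → A (preimage x) → img G (fun γ) A x
    preimage⇒img {x = x} p = preimage x , p , ≈-sym (fun∘preimage x)

    img-reflects-⊆ : ∀ {a b} {A : Pred Carrier a} {B : Pred Carrier b} → B Respects _≈_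
                   → img G (fun γ) A ⊆ img G (fun γ) B → A ⊆ B
    img-reflects-⊆ resp γA⊆γB {x} x∈A =
      resp (fun-injective (fun∘preimage (fun γ x))) (img⇒preimage resp (γA⊆γB (x , x∈A , ≈-refl)))

  img-∘ : ∀ {a} (γ δ η : Aut G) → (∀ x → fun η x ≈ fun γ (fun δ x)) → {A : Pred Carrier a}
        → img G (fun η) A ≐ img G (fun γ) (img G (fun δ) A)
  img-∘ γ δ η η≈γδ =
      (λ (a , a∈A , x≈ηa) → fun δ a , (a , a∈A , ≈-refl) , ≈-trans x≈ηa (η≈γδ a))
    , (λ (b , (a , a∈A , b≈δa) , x≈γb) →
         a , a∈A , ≈-trans x≈γb (≈-trans (fun-cong γ b≈δa) (≈-sym (η≈γδ a))))

  module _ {n : ℕ} {ℓ' : Level} (K : Fin (suc n) → Pred Carrier ℓ') where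

    A3⇒K-injective : (∀ i → ¬ (Kτ G K ⊤ ≐ Kτ G K (⊤ - i)))
                   → ∀ {i j} → K i ≐ K j → i ≡ j
    A3⇒K-injective A3 {i} {j} (Ki⊆Kj , _) with i ≟ j
    ... | yes i≡j = i≡j
    ... | no i≢j = ⊥-elim (A3 j ((λ x∈KI k _ → x∈KI k ∈⊤) , drop-j-harmless))
      where
      drop-j-harmless : Kτ G K (⊤ - j) ⊆ Kτ G K ⊤
      drop-j-harmless x∈K k _ with k ≟ j
      ... | yes refl = Ki⊆Kj (x∈K i (x∈p∧x≢y⇒x∈p-y ∈⊤ i≢j))
      ... | no k≢j = x∈K k (x∈p∧x≢y⇒x∈p-y ∈⊤ k≢j)

    img-Kτ : (γ : Aut G) (ψ : Permutation′ (suc n)) → (∀ i → K i Respects _≈_)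
           → (∀ i → img G (fun γ) (K i) ≐ K (ψ ⟨$⟩ʳ i))
           → ∀ τ → img G (fun γ) (Kτ G K τ) ≐ Kτ G K (permImage ψ τ)
    img-Kτ γ ψ resp γKi≐Kψi τ = γKτ⊆ , ⊆γKτ
      where
      γKτ⊆ : img G (fun γ) (Kτ G K τ) ⊆ Kτ G K (permImage ψ τ)
      γKτ⊆ (a , a∈Kτ , x≈γa) j j∈ψτ =
        subst (λ k → K k _) (inverseʳ ψ)
              (proj₁ (γKi≐Kψi (ψ ⟨$⟩ˡ j)) (a , a∈Kτ _ (∈-permImage⁻ ψ j∈ψτ) , x≈γa))
      ⊆γKτ : Kτ G K (permImage ψ τ) ⊆ img G (fun γ) (Kτ G K τ)
      ⊆γKτ x∈K = preimage⇒img γ λ i i∈τ →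
        img⇒preimage γ (resp i) (proj₂ (γKi≐Kψi i) (x∈K _ (∈-permImage⁺ ψ i∈τ)))

    module _ (S : IsSubgroupGeometrySystem G K) where
      open IsSubgroupGeometrySystem S using (subgroups; A3)

      K-respects : ∀ i → K i Respects _≈_
      K-respects i = IsSubgroup.resp (subgroups i)

      K-injective : ∀ {i j} → K i ≐ K j → i ≡ j
      K-injective = A3⇒K-injective A3

      img-index-unique : ∀ (γ : Aut G) {i j k}
                       → img G (fun γ) (K i) ≐ K j → img G (fun γ) (K i) ≐ K k → j ≡ k
      img-index-unique γ γKi≐Kj γKi≐Kk = K-injective (≐-trans (≐-sym γKi≐Kj) γKi≐Kk)

      img-≐-reflects : ∀ (γ : Aut G) {i j}
                     → img G (fun γ) (K i) ≐ img G (fun γ) (K j) → K i ≐ K j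
      img-≐-reflects γ {i} {j} (γKi⊆γKj , γKj⊆γKi) =
        img-reflects-⊆ γ (K-respects j) γKi⊆γKj , img-reflects-⊆ γ (K-respects i) γKj⊆γKi

      module Induced (γ : Aut G)
          (forward : ∀ i → ∃ λ j → img G (fun γ) (K i) ≐ K j)
          (backward : ∀ j → ∃ λ i → img G (fun γ) (K i) ≐ K j) where

        private
          f g : Fin (suc n) → Fin (suc n)
          f i = proj₁ (forward i)
          g j = proj₁ (backward j)

          f∘g : ∀ j → f (g j) ≡ j
          f∘g j = img-index-unique γ (proj₂ (forward (g j))) (proj₂ (backward j))

          g∘f : ∀ i → g (f i) ≡ i
          g∘f i = K-injective (img-≐-reflects γ
                    (≐-trans (proj₂ (backward (f i))) (≐-sym (proj₂ (forward i)))))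

        perm : Permutation′ (suc n)
        perm = permutation f g f∘g g∘f

        img-K : ∀ i → img G (fun γ) (K i) ≐ K (perm ⟨$⟩ʳ i)
        img-K i = proj₂ (forward i)

proposition2p10 : ∀ {c ℓ ℓ' ℓ''} (G : Group c ℓ) (n : ℕ)
    (K : Fin (suc n) → Pred (Group.Carrier G) ℓ') → IsSubgroupGeometrySystem G K
    → (Γ : Pred (Aut G) ℓ'') → IsAutSubgroup G Γ → Preserves G K Γ
    → Σ ((γ : Aut G) → Γ γ → Permutation′ (suc n)) λ Ψ →
        (∀ γ (p : Γ γ) i → img G (fun γ) (K i) ≐ K (Ψ γ p ⟨$⟩ʳ i))
      × (∀ γ (p : Γ γ) (f : Fin (suc n) → Fin (suc n))
           → (∀ i → img G (fun γ) (K i) ≐ K (f i)) → ∀ i → f i ≡ Ψ γ p ⟨$⟩ʳ i)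
      × (∀ γ δ η (p : Γ γ) (q : Γ δ) (r : Γ η)
           → (∀ x → Group._≈_ G (fun η x) (fun γ (fun δ x)))
           → ∀ i → Ψ η r ⟨$⟩ʳ i ≡ Ψ γ p ⟨$⟩ʳ (Ψ δ q ⟨$⟩ʳ i))
      × (∀ γ (p : Γ γ) (τ : Subset (suc n))
           → img G (fun γ) (Kτ G K τ) ≐ Kτ G K (permImage (Ψ γ p) τ))
proposition2p10 G n K S Γ _ preserves = Ψ , ψ-spec , ψ-unique , ψ-hom , ψ-Kτ
  where
  module I γ (p : Γ γ) = Induced G K S γ (proj₁ (preserves γ p)) (proj₂ (preserves γ p))

  Ψ : (γ : Aut G) → Γ γ → Permutation′ (suc n)
  Ψ = I.perm

  ψ-spec : ∀ γ (p : Γ γ) i → img G (fun γ) (K i) ≐ K (Ψ γ p ⟨$⟩ʳ i)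
  ψ-spec = I.img-K

  ψ-unique : ∀ γ (p : Γ γ) (f : Fin (suc n) → Fin (suc n))
           → (∀ i → img G (fun γ) (K i) ≐ K (f i)) → ∀ i → f i ≡ Ψ γ p ⟨$⟩ʳ i
  ψ-unique γ p f γKi≐Kfi i = img-index-unique G K S γ (γKi≐Kfi i) (ψ-spec γ p i)

  ψ-hom : ∀ γ δ η (p : Γ γ) (q : Γ δ) (r : Γ η)
        → (∀ x → Group._≈_ G (fun η x) (fun γ (fun δ x)))
        → ∀ i → Ψ η r ⟨$⟩ʳ i ≡ Ψ γ p ⟨$⟩ʳ (Ψ δ q ⟨$⟩ʳ i)
  ψ-hom γ δ η p q r η≈γδ i = img-index-unique G K S η (ψ-spec η r i)
    (≐-trans (img-∘ G γ δ η η≈γδ)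
      (≐-trans (img-cong G (fun γ) (ψ-spec δ q i)) (ψ-spec γ p _)))

  ψ-Kτ : ∀ γ (p : Γ γ) τ → img G (fun γ) (Kτ G K τ) ≐ Kτ G K (permImage (Ψ γ p) τ)
  ψ-Kτ γ p = img-Kτ G K γ (Ψ γ p) (K-respects G K S) (ψ-spec γ p)
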